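{- Consider a clause-database state with parameter $n\in\mathbb{N}$ (as described in the context) that satisfies the Representation invariant and the Closure invariant. Then $N \leftrightarrow^n P$, i.e. $\tau^{\le n} \models (N \leftrightarrow P)$, where $N = D_0\cup D_1\cup\cdots\cup D_n$ and $P = D_0 \cup \bigcup_{k=1}^{n} S_k^0$.
   Context: A clause is a finite set of pairwise distinct literals (read as their disjunction); a finite set of clauses is read as their conjunction (the empty set is true). Fix a CNF formula $I$ (the input clauses) and a trail $\tau=\langle \ell_1@d_1,\ldots,\ell_k@d_k\rangle$: a finite sequence of literals over pairwise distinct variables, each annotated with a decision level $d_j\in\mathbb{N}$, with $d_1\le\cdots\le d_k$ (and such that every literal that is not the first literal of its positive level is implied by $I$ together with the earlier first-literals-of-levels). For $d\in\mathbb{N}$, $\tau^{\le d}$ is the subsequence of literals with level $\le d$, viewed as a partial assignment. For a formula $\varphi$, $\tau^{\le d}\models\varphi$ means every total assignment extending $\tau^{\le d}$ satisfies $\varphi$. Write $\varphi\to^d\psi$ if $\tau^{\le d}\models(\varphi\to\psi)$ and $\varphi\leftrightarrow^d\psi$ if $\tau^{\le d}\models(\varphi\leftrightarrow\psi)$. A clause-database state with parameter $n$ consists of pairwise disjoint finite sets of clauses: active groups $D_0,D_1,\ldots,D_n,D_\infty$ and stashed groups $S_k^q$ for $1\le k\le n$, $0\le q<k$. Notation: $S_k=\bigcup_{q<k}S_k^q$; $S=\bigcup_{k=1}^n S_k$; $S^i=\bigcup_{k} S_k^i$; $P=D_0\cup S^0$ (pervasive); $D=D_1\cup\cdots\cup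 D_n$; $N=D_0\cup D$; $A=N\cup D_\infty$ (active). Representation invariant: for every $i$ with $1\le i\le n$ and every $\alpha\in S_i$, at least one of: (a) there are $r$ with $0\le r\le i$ and $\beta\in D_r$ with $\beta\to^i\alpha$; (b) there are $r\le i$, $j$ with $i<j\le n$, and $\beta\in S_j^r$ with $\beta\to^i\alpha$; (c) $\tau^{\le i}\models\alpha$. Closure invariant: for every $\gamma\in A\cup S$, $P\to^0\gamma$. -}

module Defs where

open import Data.Bool using (Bool)
open import Data.Nat using (ℕ; _≤_; _<_; _≤?_)
open import Data.Fin using (Fin; toℕ)
open import Data.Product using (_×_; _,_; proj₁; proj₂; ∃-syntax)
open import Data.Sum using (_⊎_)
open import Data.Empty using (⊥)
open import Data.Unit using (⊤)
open import Data.List using (List; filter; map; length; lookup)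
open import Data.List.Relation.Unary.All using (All)
open import Data.List.Relation.Unary.Any using (Any)
open import Data.List.Relation.Unary.Linked using (Linked)
open import Data.List.Relation.Unary.Unique.Propositional using (Unique)
open import Data.List.Membership.Propositional using (_∈_)
open import Relation.Binary.PropositionalEquality using (_≡_; _≢_)
open import Relation.Nullary using (¬_)

Var : Set
Var = ℕ

-- a literal is a variable with a polarity (true = positive)
record Literal : Set where
  constructor lit
  field
    var : Var
    pol : Bool
open Literal public

Clause : Set
Clause = List Literal

WFClause : Clause → Set
WFClause = Unique

CNF : Set
CNF = List Clause

Assignment : Set
Assignment = Var → Bool

LitSat : Assignment → Literal → Set
LitSat σ l = σ (var l) ≡ pol l

ClauseSat : Assignment → Clause → Set
ClauseSat σ C = Any (LitSat σ) C

CNFSat : Assignment → CNF → Set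
CNFSat σ F = All (ClauseSat σ) F

Extends : Assignment → List Literal → Set
Extends σ ρ = All (LitSat σ) ρ

-- a trail entry: literal annotated with its decision level
Trail : Set
Trail = List (Literal × ℕ)

-- τ^{≤ d} viewed as a partial assignment
_≤lvl_ : Trail → ℕ → List Literal
τ ≤lvl d = map proj₁ (filter (λ e → proj₂ e ≤? d) τ)

entryLit : (τ : Trail) → Fin (length τ) → Literal
entryLit τ j = proj₁ (lookup τ j)

entryLvl : (τ : Trail) → Fin (length τ) → ℕ
entryLvl τ j = proj₂ (lookup τ j)

FirstOfPosLevel : (τ : Trail) → Fin (length τ) → Set
FirstOfPosLevel τ j =
  (0 < entryLvl τ j) ×
  (∀ (i : Fin (length τ)) → toℕ i < toℕ j → entryLvl τ i ≢ entryLvl τ j)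

record WFTrail (I : CNF) (τ : Trail) : Set where
  field
    distinctVars : Unique (map (λ e → var (proj₁ e)) τ)
    sortedLevels : Linked _≤_ (map proj₂ τ)
    implied : ∀ (j : Fin (length τ)) → ¬ FirstOfPosLevel τ j →
      ∀ (σ : Assignment) → CNFSat σ I →
      (∀ (i : Fin (length τ)) → toℕ i < toℕ j → FirstOfPosLevel τ i →
         LitSat σ (entryLit τ i)) →
      LitSat σ (entryLit τ j)

ImpliesAt : Trail → ℕ → Clause → Clause → Set
ImpliesAt τ d β α = ∀ (σ : Assignment) → Extends σ (τ ≤lvl d) →
  ClauseSat σ β → ClauseSat σ α

ModelsAt : Trail → ℕ → Clause → Set
ModelsAt τ d α = ∀ (σ : Assignment) → Extends σ (τ ≤lvl d) → ClauseSat σ α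

-- Only D r for r ≤ n and S k q for 1 ≤ k ≤ n, q < k are meaningful.
record DBState : Set where
  field
    D    : ℕ → CNF
    Dinf : CNF
    S    : ℕ → ℕ → CNF
open DBState public

data Label : Set where
  dL   : ℕ → Label
  infL : Label
  sL   : ℕ → ℕ → Label

ValidLabel : ℕ → Label → Set
ValidLabel n (dL r)   = r ≤ n
ValidLabel n infL     = ⊤
ValidLabel n (sL k q) = (1 ≤ k) × (k ≤ n) × (q < k)

group : DBState → Label → CNF
group st (dL r)   = D st r
group st infL     = Dinf st
group st (sL k q) = S st k q

Disjoint : CNF → CNF → Set
Disjoint F G = ∀ (γ : Clause) → γ ∈ F → γ ∈ G → ⊥

record WFState (n : ℕ) (st : DBState) : Set where
  field
    clausesWF : ∀ (g : Label) → ValidLabel n g → All WFClause (group st g)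
    groupsSets : ∀ (g : Label) → ValidLabel n g → Unique (group st g)
    disjoint : ∀ (g h : Label) → ValidLabel n g → ValidLabel n h → g ≢ h →
      Disjoint (group st g) (group st h)

InSk : ℕ → DBState → ℕ → Clause → Set
InSk n st k γ = ∃[ q ] (q < k × γ ∈ S st k q)

InS : ℕ → DBState → Clause → Set
InS n st γ = ∃[ k ] (1 ≤ k × k ≤ n × InSk n st k γ)

InP : ℕ → DBState → Clause → Set
InP n st γ = γ ∈ D st 0 ⊎ ∃[ k ] (1 ≤ k × k ≤ n × γ ∈ S st k 0)

InN : ℕ → DBState → Clause → Set
InN n st γ = ∃[ r ] (r ≤ n × γ ∈ D st r)

InA : ℕ → DBState → Clause → Set
InA n st γ = InN n st γ ⊎ γ ∈ Dinf st

SatSet : Assignment → (Clause → Set) → Set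
SatSet σ X = ∀ (γ : Clause) → X γ → ClauseSat σ γ

RepInv : Trail → ℕ → DBState → Set
RepInv τ n st = ∀ (i : ℕ) → 1 ≤ i → i ≤ n → ∀ (α : Clause) → InSk n st i α →
    (∃[ r ] ∃[ β ] (r ≤ i × β ∈ D st r × ImpliesAt τ i β α))
  ⊎ (∃[ r ] ∃[ j ] ∃[ β ] (r ≤ i × i < j × j ≤ n × β ∈ S st j r × ImpliesAt τ i β α))
  ⊎ ModelsAt τ i α

ClosureInv : Trail → ℕ → DBState → Set
ClosureInv τ n st = ∀ (γ : Clause) → InA n st γ ⊎ InS n st γ →
  ∀ (σ : Assignment) → Extends σ (τ ≤lvl 0) → SatSet σ (InP n st) → ClauseSat σ γ

EquivAt : Trail → ℕ → (Clause → Set) → (Clause → Set) → Set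
EquivAt τ d X Y = ∀ (σ : Assignment) → Extends σ (τ ≤lvl d) →
  (SatSet σ X → SatSet σ Y) × (SatSet σ Y → SatSet σ X)

-- Under τ^{≤n}, N entails every stashed clause. This goes by downward induction on the
-- stash index i ≤ n: by the representation invariant a clause of S_i follows at level
-- i ≤ n from a clause of N, from a clause of some S_j with j > i, or from τ^{≤i} alone.
-- In particular N entails P = D_0 ∪ S^0. Conversely every clause of N ⊆ A follows from
-- P at level 0 ≤ n by the closure invariant.
module Submission where

open import Defs
open import Data.Nat using (ℕ; _≤_; _<_; _∸_; _≤?_; z≤n)
open import Data.Nat.Properties using (≤-trans; ≤-<-trans; <⇒≤; ∸-monoʳ-<)
open import Data.Nat.Induction using (<-wellFounded)
open import Data.Product using (_,_; proj₁; proj₂)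
open import Data.Sum using (inj₁; inj₂)
open import Data.List.Relation.Binary.Subset.Propositional using (_⊆_)
open import Data.List.Relation.Binary.Subset.Propositional.Properties using (⊆-refl; map⁺; filter⁺′)
open import Data.List.Relation.Unary.All.Properties using (anti-mono)
open import Induction.WellFounded using (Acc; acc)
open import Level using (Level)

downward-induction : ∀ {ℓ : Level} (P : ℕ → Set ℓ) (n : ℕ) →
  (∀ i → i ≤ n → (∀ j → i < j → j ≤ n → P j) → P i) →
  ∀ i → i ≤ n → P i
downward-induction P n step i i≤n = go i i≤n (<-wellFounded (n ∸ i))
  where
  go : ∀ i → i ≤ n → Acc _<_ (n ∸ i) → P i
  go i i≤n (acc rs) = step i i≤n λ j i<j j≤n → go j j≤n (rs (∸-monoʳ-< i<j j≤n))

≤lvl-mono : (τ : Trail) {d e : ℕ} → d ≤ e → τ ≤lvl d ⊆ τ ≤lvl e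
≤lvl-mono τ {d} {e} d≤e = map⁺ proj₁
  (filter⁺′ (λ x → proj₂ x ≤? d) (λ x → proj₂ x ≤? e) (λ x≤d → ≤-trans x≤d d≤e) {τ} ⊆-refl)

Extends-≤lvl-anti : (σ : Assignment) (τ : Trail) {d e : ℕ} → d ≤ e →
  Extends σ (τ ≤lvl e) → Extends σ (τ ≤lvl d)
Extends-≤lvl-anti σ τ d≤e = anti-mono (≤lvl-mono τ d≤e)

N-entails-stash : ∀ {τ n st σ} → RepInv τ n st →
  Extends σ (τ ≤lvl n) → SatSet σ (InN n st) →
  ∀ k → k ≤ n → 1 ≤ k → SatSet σ (InSk n st k)
N-entails-stash {τ} {n} {st} {σ} rep σ⊨τ σ⊨N =
  downward-induction (λ i → 1 ≤ i → SatSet σ (InSk n st i)) n step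
  where
  σ⊨τ≤ : ∀ {i} → i ≤ n → Extends σ (τ ≤lvl i)
  σ⊨τ≤ i≤n = Extends-≤lvl-anti σ τ i≤n σ⊨τ

  step : ∀ i → i ≤ n → (∀ j → i < j → j ≤ n → 1 ≤ j → SatSet σ (InSk n st j)) →
    1 ≤ i → SatSet σ (InSk n st i)
  step i i≤n ih 1≤i α α∈Sᵢ with rep i 1≤i i≤n α α∈Sᵢ
  ... | inj₁ (r , β , r≤i , β∈Dᵣ , β⇒α) =
    β⇒α σ (σ⊨τ≤ i≤n) (σ⊨N β (r , ≤-trans r≤i i≤n , β∈Dᵣ))
  ... | inj₂ (inj₁ (r , j , β , r≤i , i<j , j≤n , β∈Sⱼʳ , β⇒α)) =
    β⇒α σ (σ⊨τ≤ i≤n) (ih j i<j j≤n (≤-trans 1≤i (<⇒≤ i<j)) β (r , ≤-<-trans r≤i i<j , β∈Sⱼʳ))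
  ... | inj₂ (inj₂ τ⊨α) = τ⊨α σ (σ⊨τ≤ i≤n)

lemma1 : (I : CNF) (τ : Trail) → WFTrail I τ →
    (n : ℕ) (st : DBState) → WFState n st →
    RepInv τ n st → ClosureInv τ n st →
    EquivAt τ n (InN n st) (InP n st)
lemma1 I τ _ n st _ rep clo σ σ⊨τ = N⇒P , P⇒N
  where
  N⇒P : SatSet σ (InN n st) → SatSet σ (InP n st)
  N⇒P σ⊨N γ (inj₁ γ∈D₀) = σ⊨N γ (0 , z≤n , γ∈D₀)
  N⇒P σ⊨N γ (inj₂ (k , 1≤k , k≤n , γ∈Sₖ⁰)) =
    N-entails-stash {τ} {n} {st} rep σ⊨τ σ⊨N k k≤n 1≤k γ (0 , 1≤k , γ∈Sₖ⁰)

  P⇒N : SatSet σ (InP n st) → SatSet σ (InN n st)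
  P⇒N σ⊨P γ γ∈N = clo γ (inj₁ (inj₁ γ∈N)) σ (Extends-≤lvl-anti σ τ z≤n σ⊨τ) σ⊨P
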